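{- Let $S$ be a Steiner triple system of order $n$. Then $\alpha(S)=\binom{n}{3}-\frac{1}{3}\binom{n}{2}$ if and only if $\beta(S)=\binom{n}{3}$.
   Context: A Steiner triple system of order $n$ is a pair $(X,S)$ with $|X|=n$ and $S$ a set of 3-subsets of $X$ (blocks) such that every pair of distinct elements of $X$ lies in exactly one block. The associated quasigroup operation: $a\star a=a$ and for $a\neq b$, $a\star b$ is the third element of the block containing $a,b$. Define $A(S)=\{\{a\star b,b\star c,c\star a\} : a,b,c\in X \text{ distinct}, \{a,b,c\}\notin S\}$, $B(S)=\{\{a\star b,b\star c,c\star a\} : a,b,c\in X \text{ distinct}\}$, $\alpha(S)=|A(S)|$, $\beta(S)=|B(S)|$. -}

module Defs where

open import Data.Nat using (ℕ)
open import Data.Bool using (Bool; true; false; if_then_else_)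
import Data.Bool.Properties as BoolP
open import Data.Fin using (Fin; _≟_)
open import Data.Fin.Subset using (Subset; ⁅_⁆; _∪_; ∣_∣) renaming (_∈_ to _∈ₛ_)
open import Data.Fin.Properties using (any?)
open import Data.Vec.Properties using (≡-dec)
open import Data.List using (List; []; _∷_; allFin; concatMap; length; deduplicate)
open import Data.List.Relation.Unary.Unique.Propositional using (Unique)
open import Data.List.Relation.Unary.All using (All)
open import Data.Product using (Σ; _×_; _,_; proj₁)
open import Relation.Binary.PropositionalEquality using (_≡_; _≢_)
open import Relation.Binary.Definitions using (DecidableEquality)
open import Relation.Nullary using (Dec; yes; no; ¬_)
open import Relation.Nullary.Decidable using (⌊_⌋)
import Data.List.Membership.DecPropositional as DecMem

_≟ₛ_ : ∀ {n} → DecidableEquality (Subset n)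
_≟ₛ_ = ≡-dec BoolP._≟_

module _ {n : ℕ} where
  open DecMem (_≟ₛ_ {n}) public using (_∈_; _∈?_)

triple : ∀ {n} → Fin n → Fin n → Fin n → Subset n
triple a b c = ⁅ a ⁆ ∪ (⁅ b ⁆ ∪ ⁅ c ⁆)

record IsSTS {n : ℕ} (S : List (Subset n)) : Set where
  field
    isSet      : Unique S
    blocks-3   : All (λ B → ∣ B ∣ ≡ 3) S
    pair-cover : ∀ (x y : Fin n) → x ≢ y →
                   Σ (Subset n) λ B → B ∈ S × x ∈ₛ B × y ∈ₛ B
    pair-unique : ∀ (x y : Fin n) → x ≢ y → ∀ B B' →
                   B ∈ S → x ∈ₛ B → y ∈ₛ B →
                   B' ∈ S → x ∈ₛ B' → y ∈ₛ B' → B ≡ B'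

-- The associated quasigroup operation: a ⋆ a = a; for a ≠ b, a ⋆ b is the
-- (unique, for an STS) c with {a,b,c} ∈ S.  (Default a if no such c exists,
-- which never happens for an STS.)
star : ∀ {n} → List (Subset n) → Fin n → Fin n → Fin n
star S a b with a ≟ b
... | yes _ = a
... | no _ with any? (λ c → triple a b c ∈? S)
...   | yes (c , _) = c
...   | no _ = a

images : ∀ {n} → List (Subset n) → (Fin n → Fin n → Fin n → Bool) → List (Subset n)
images {n} S keep =
  concatMap (λ a → concatMap (λ b → concatMap (λ c →
    if ⌊ a ≟ b ⌋ then [] else
    if ⌊ b ≟ c ⌋ then [] else
    if ⌊ a ≟ c ⌋ then [] else
    if keep a b c
      then triple (star S a b) (star S b c) (star S c a) ∷ []
      else []) (allFin n)) (allFin n)) (allFin n)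

A-list : ∀ {n} → List (Subset n) → List (Subset n)
A-list S = deduplicate _≟ₛ_ (images S (λ a b c → if ⌊ triple a b c ∈? S ⌋ then false else true))

B-list : ∀ {n} → List (Subset n) → List (Subset n)
B-list S = deduplicate _≟ₛ_ (images S (λ _ _ _ → true))

α : ∀ {n} → List (Subset n) → ℕ
α S = length (A-list S)

β : ∀ {n} → List (Subset n) → ℕ
β S = length (B-list S)

module Submission where

-- Write products X = {x ⋆ y | x ≠ y in X}.  On a triple {a,b,c} of distinct
-- points this is the triangle {a⋆b, b⋆c, c⋆a}, so B(S) and A(S) are the images
-- under `products` of the list T of all 3-subsets and of the list N of
-- non-blocks, and `products` fixes every block.  Counting pairs gives
-- 3|S| = C(n,2), so the two target values are |N| and |T|, and each side of
-- the equivalence forces `products` to be injective on N (a duplicate-free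
-- image is as long as the list only if no two entries collide).  The
-- geometric input is the Pasch configuration: a non-block whose triangle is a
-- block yields two distinct non-blocks with equal products.  Hence under
-- either hypothesis `products` maps N into N, and a pigeonhole argument gives
-- A(S) = N and B(S) = N ∪ S = T.

open import Defs hiding (_∈_)
open import Data.Nat using (ℕ; zero; suc; _+_; _*_; _∸_; _/_; _≤_; _<_; z≤n; s≤s)
import Data.Nat.Properties as ℕP
open import Data.Nat.DivMod using (m*n/n≡m)
open import Data.Nat.Combinatorics using (_C_; nCk+nC[k+1]≡[n+1]C[k+1])
open import Data.Bool using (Bool; true; false; T; if_then_else_)
open import Data.Fin using (Fin; zero; suc; _≟_)
open import Data.Fin.Properties using (any?)
open import Data.Fin.Subset using (Subset; ⁅_⁆; _∪_; ∣_∣)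
  renaming (⊥ to ∅; _∈_ to _∈ₛ_; _∉_ to _∉ₛ_; _⊆_ to _⊆ₛ_)
open import Data.Fin.Subset.Properties
  using (⊆-antisym; _⊆?_; x∈p∪q⁻; x∈p∪q⁺; x∈⁅x⁆; x∈⁅y⁆⇒x≡y; ∣⁅x⁆∣≡1;
         ∪-assoc; ∪-comm; ∪-idem; ∪-identityˡ; ∪-identityʳ)
  renaming (_∈?_ to _∈ₛ?_)
open import Data.Vec.Base using ([]; _∷_; here; there; tabulate)
open import Data.Vec.Properties using (∷-injectiveʳ; lookup∘tabulate; []=⇒lookup; lookup⇒[]=)
open import Data.List using (List; []; _∷_; _++_; map; length; filter; concatMap; allFin)
open import Data.List.Properties using (length-++; length-++-sucʳ; length-map)
open import Data.List.Relation.Unary.Any as Any using (here; there)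
open import Data.List.Relation.Unary.All as All using ([]; _∷_)
open import Data.List.Relation.Unary.Unique.Propositional using (Unique; []; _∷_)
import Data.List.Relation.Unary.Unique.Propositional.Properties as Unique
import Data.List.Relation.Unary.Unique.DecPropositional.Properties as DecUnique
open import Data.List.Membership.Propositional using (_∈_; find; lose)
open import Data.List.Membership.Propositional.Properties
  using (∈-∃++; ∈-++⁻; ∈-++⁺ˡ; ∈-++⁺ʳ; ∈-map⁺; ∈-map⁻; ∈-concatMap⁺; ∈-concatMap⁻; ∈-allFin;
         ∈-filter⁺; ∈-filter⁻; ∈-deduplicate⁺; ∈-deduplicate⁻)
open import Data.List.Relation.Binary.Subset.Propositional using (_⊆_)
open import Data.Sum using (_⊎_; inj₁; inj₂)
open import Data.Product using (Σ; ∃; ∃₂; _×_; _,_; proj₁; proj₂)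
open import Data.Empty using (⊥; ⊥-elim)
open import Function using (_∘_)
open import Function.Bundles using (_⇔_; mk⇔)
open import Relation.Nullary using (¬_; Dec; yes; no)
open import Relation.Nullary.Decidable using (⌊_⌋; ¬?; _×-dec_; toWitness; dec-true; isYes≗does)
open import Relation.Unary using (Pred; Decidable)
open import Relation.Binary.Definitions using (DecidableEquality)
open import Relation.Binary.PropositionalEquality

private variable
  n : ℕ
  a b c x y : Fin n

In₃ : Fin n → Fin n → Fin n → Fin n → Set
In₃ x a b c = x ≡ a ⊎ x ≡ b ⊎ x ≡ c

∈triple⁻ : x ∈ₛ triple a b c → In₃ x a b c
∈triple⁻ {a = a} {b} {c} x∈ with x∈p∪q⁻ ⁅ a ⁆ (⁅ b ⁆ ∪ ⁅ c ⁆) x∈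
... | inj₁ x∈a = inj₁ (x∈⁅y⁆⇒x≡y a x∈a)
... | inj₂ x∈bc with x∈p∪q⁻ ⁅ b ⁆ ⁅ c ⁆ x∈bc
...   | inj₁ x∈b = inj₂ (inj₁ (x∈⁅y⁆⇒x≡y b x∈b))
...   | inj₂ x∈c = inj₂ (inj₂ (x∈⁅y⁆⇒x≡y c x∈c))

∈triple⁺ : In₃ x a b c → x ∈ₛ triple a b c
∈triple⁺ (inj₁ refl)        = x∈p∪q⁺ (inj₁ (x∈⁅x⁆ _))
∈triple⁺ (inj₂ (inj₁ refl)) = x∈p∪q⁺ (inj₂ (x∈p∪q⁺ (inj₁ (x∈⁅x⁆ _))))
∈triple⁺ (inj₂ (inj₂ refl)) = x∈p∪q⁺ (inj₂ (x∈p∪q⁺ (inj₂ (x∈⁅x⁆ _))))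

∈pair⁻ : x ∈ₛ ⁅ a ⁆ ∪ ⁅ b ⁆ → x ≡ a ⊎ x ≡ b
∈pair⁻ {a = a} {b} x∈ with x∈p∪q⁻ ⁅ a ⁆ ⁅ b ⁆ x∈
... | inj₁ x∈a = inj₁ (x∈⁅y⁆⇒x≡y a x∈a)
... | inj₂ x∈b = inj₂ (x∈⁅y⁆⇒x≡y b x∈b)

∈pair⁺ : x ≡ a ⊎ x ≡ b → x ∈ₛ ⁅ a ⁆ ∪ ⁅ b ⁆
∈pair⁺ (inj₁ refl) = x∈p∪q⁺ (inj₁ (x∈⁅x⁆ _))
∈pair⁺ (inj₂ refl) = x∈p∪q⁺ (inj₂ (x∈⁅x⁆ _))

triple-swap₁₂ : (a b c : Fin n) → triple a b c ≡ triple b a c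
triple-swap₁₂ a b c = begin
  ⁅ a ⁆ ∪ (⁅ b ⁆ ∪ ⁅ c ⁆)  ≡⟨ ∪-assoc ⁅ a ⁆ ⁅ b ⁆ ⁅ c ⁆ ⟨
  (⁅ a ⁆ ∪ ⁅ b ⁆) ∪ ⁅ c ⁆  ≡⟨ cong (_∪ ⁅ c ⁆) (∪-comm ⁅ a ⁆ ⁅ b ⁆) ⟩
  (⁅ b ⁆ ∪ ⁅ a ⁆) ∪ ⁅ c ⁆  ≡⟨ ∪-assoc ⁅ b ⁆ ⁅ a ⁆ ⁅ c ⁆ ⟩
  ⁅ b ⁆ ∪ (⁅ a ⁆ ∪ ⁅ c ⁆)  ∎
  where open ≡-Reasoning

triple-swap₂₃ : (a b c : Fin n) → triple a b c ≡ triple a c b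
triple-swap₂₃ a b c = cong (⁅ a ⁆ ∪_) (∪-comm ⁅ b ⁆ ⁅ c ⁆)

triple-rotate : (a b c : Fin n) → triple a b c ≡ triple b c a
triple-rotate a b c = trans (triple-swap₁₂ a b c) (triple-swap₂₃ b a c)

triple-pairs : (P : Fin n → Fin n → Set) → (∀ x y → P x y → P y x) →
               P a b → P b c → P c a →
               In₃ x a b c → In₃ y a b c → x ≢ y → P x y
triple-pairs P P-sym pab pbc pca (inj₁ refl)        (inj₁ refl)        x≢y = ⊥-elim (x≢y refl)
triple-pairs P P-sym pab pbc pca (inj₁ refl)        (inj₂ (inj₁ refl)) x≢y = pab
triple-pairs P P-sym pab pbc pca (inj₁ refl)        (inj₂ (inj₂ refl)) x≢y = P-sym _ _ pca
triple-pairs P P-sym pab pbc pca (inj₂ (inj₁ refl)) (inj₁ refl)        x≢y = P-sym _ _ pab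
triple-pairs P P-sym pab pbc pca (inj₂ (inj₁ refl)) (inj₂ (inj₁ refl)) x≢y = ⊥-elim (x≢y refl)
triple-pairs P P-sym pab pbc pca (inj₂ (inj₁ refl)) (inj₂ (inj₂ refl)) x≢y = pbc
triple-pairs P P-sym pab pbc pca (inj₂ (inj₂ refl)) (inj₁ refl)        x≢y = pca
triple-pairs P P-sym pab pbc pca (inj₂ (inj₂ refl)) (inj₂ (inj₁ refl)) x≢y = P-sym _ _ pbc
triple-pairs P P-sym pab pbc pca (inj₂ (inj₂ refl)) (inj₂ (inj₂ refl)) x≢y = ⊥-elim (x≢y refl)

∣⁅x⁆∪p∣≤1+∣p∣ : (x : Fin n) (p : Subset n) → ∣ ⁅ x ⁆ ∪ p ∣ ≤ suc ∣ p ∣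
∣⁅x⁆∪p∣≤1+∣p∣ zero    (true  ∷ p) = s≤s (ℕP.≤-trans (ℕP.≤-reflexive (cong ∣_∣ (∪-identityˡ p))) (ℕP.n≤1+n _))
∣⁅x⁆∪p∣≤1+∣p∣ zero    (false ∷ p) = s≤s (ℕP.≤-reflexive (cong ∣_∣ (∪-identityˡ p)))
∣⁅x⁆∪p∣≤1+∣p∣ (suc x) (true  ∷ p) = s≤s (∣⁅x⁆∪p∣≤1+∣p∣ x p)
∣⁅x⁆∪p∣≤1+∣p∣ (suc x) (false ∷ p) = ∣⁅x⁆∪p∣≤1+∣p∣ x p

∣⁅x⁆∪p∣≡1+∣p∣ : (x : Fin n) (p : Subset n) → x ∉ₛ p → ∣ ⁅ x ⁆ ∪ p ∣ ≡ suc ∣ p ∣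
∣⁅x⁆∪p∣≡1+∣p∣ zero    (true  ∷ p) x∉p = ⊥-elim (x∉p here)
∣⁅x⁆∪p∣≡1+∣p∣ zero    (false ∷ p) x∉p = cong (suc ∘ ∣_∣) (∪-identityˡ p)
∣⁅x⁆∪p∣≡1+∣p∣ (suc x) (true  ∷ p) x∉p = cong suc (∣⁅x⁆∪p∣≡1+∣p∣ x p (x∉p ∘ there))
∣⁅x⁆∪p∣≡1+∣p∣ (suc x) (false ∷ p) x∉p = ∣⁅x⁆∪p∣≡1+∣p∣ x p (x∉p ∘ there)

∣pair∣≤2 : (x y : Fin n) → ∣ ⁅ x ⁆ ∪ ⁅ y ⁆ ∣ ≤ 2
∣pair∣≤2 x y = subst (λ k → ∣ ⁅ x ⁆ ∪ ⁅ y ⁆ ∣ ≤ suc k) (∣⁅x⁆∣≡1 y) (∣⁅x⁆∪p∣≤1+∣p∣ x ⁅ y ⁆)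

∣pair∣≡2 : x ≢ y → ∣ ⁅ x ⁆ ∪ ⁅ y ⁆ ∣ ≡ 2
∣pair∣≡2 {x = x} {y} x≢y =
  trans (∣⁅x⁆∪p∣≡1+∣p∣ x ⁅ y ⁆ (x≢y ∘ x∈⁅y⁆⇒x≡y y)) (cong suc (∣⁅x⁆∣≡1 y))

∣triple∣≡3 : a ≢ b → b ≢ c → a ≢ c → ∣ triple a b c ∣ ≡ 3
∣triple∣≡3 {a = a} {b} {c} a≢b b≢c a≢c =
  trans (∣⁅x⁆∪p∣≡1+∣p∣ a (⁅ b ⁆ ∪ ⁅ c ⁆) a∉bc) (cong suc (∣pair∣≡2 b≢c))
  where
  a∉bc : a ∉ₛ ⁅ b ⁆ ∪ ⁅ c ⁆
  a∉bc a∈ with ∈pair⁻ a∈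
  ... | inj₁ a≡b = a≢b a≡b
  ... | inj₂ a≡c = a≢c a≡c

-- Conversely a triple with a repeated entry is a pair, so has at most two
-- elements: the entries of a 3-element triple are distinct.
∣triple∣≡3⇒distinct : ∀ {n} {a b c : Fin n} → ∣ triple a b c ∣ ≡ 3 → a ≢ b × b ≢ c × a ≢ c
∣triple∣≡3⇒distinct {n} {a} {b} {c} ∣abc∣≡3 = a≢b , b≢c , a≢c
  where
  3≰2 : ¬ (3 ≤ 2)
  3≰2 (s≤s (s≤s ()))
  collapse : {p : Subset n} → triple a b c ≡ p → ∣ p ∣ ≤ 2 → ⊥
  collapse abc≡p ∣p∣≤2 = 3≰2 (subst (_≤ 2) (trans (cong ∣_∣ (sym abc≡p)) ∣abc∣≡3) ∣p∣≤2)
  ⁅x⁆∪⁅x⁆∪q : (x : Fin n) (q : Subset n) → ⁅ x ⁆ ∪ (⁅ x ⁆ ∪ q) ≡ ⁅ x ⁆ ∪ q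
  ⁅x⁆∪⁅x⁆∪q x q = trans (sym (∪-assoc ⁅ x ⁆ ⁅ x ⁆ q)) (cong (_∪ q) (∪-idem ⁅ x ⁆))
  a≢b : a ≢ b
  a≢b refl = collapse (⁅x⁆∪⁅x⁆∪q a ⁅ c ⁆) (∣pair∣≤2 a c)
  b≢c : b ≢ c
  b≢c refl = collapse (cong (⁅ a ⁆ ∪_) (∪-idem ⁅ b ⁆)) (∣pair∣≤2 a b)
  a≢c : a ≢ c
  a≢c refl = collapse (trans (triple-swap₂₃ a b a) (⁅x⁆∪⁅x⁆∪q a ⁅ b ⁆)) (∣pair∣≤2 a b)

∣p∣≡0⇒p≡∅ : (p : Subset n) → ∣ p ∣ ≡ 0 → p ≡ ∅
∣p∣≡0⇒p≡∅ []          _  = refl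
∣p∣≡0⇒p≡∅ (false ∷ p) ∣p∣≡0 = cong (false ∷_) (∣p∣≡0⇒p≡∅ p ∣p∣≡0)

split-point : ∀ {k} (p : Subset n) → ∣ p ∣ ≡ suc k →
  Σ (Fin n) λ x → Σ (Subset n) λ q → x ∉ₛ q × p ≡ ⁅ x ⁆ ∪ q × ∣ q ∣ ≡ k
split-point (true ∷ p) ∣p∣≡1+k =
  zero , false ∷ p , (λ ()) , cong (true ∷_) (sym (∪-identityˡ p)) , ℕP.suc-injective ∣p∣≡1+k
split-point (false ∷ p) ∣p∣≡1+k with split-point p ∣p∣≡1+k
... | x , q , x∉q , p≡xq , ∣q∣≡k =
  suc x , false ∷ q , (λ { (there x∈q) → x∉q x∈q }) , cong (false ∷_) p≡xq , ∣q∣≡k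

split-pair : (p : Subset n) → ∣ p ∣ ≡ 2 →
  Σ (Fin n) λ x → Σ (Fin n) λ y → x ≢ y × p ≡ ⁅ x ⁆ ∪ ⁅ y ⁆
split-pair p ∣p∣≡2 with split-point p ∣p∣≡2
... | x , q , x∉q , p≡xq , ∣q∣≡1 with split-point q ∣q∣≡1
... | y , r , _ , q≡yr , ∣r∣≡0 = x , y , x≢y , trans p≡xq (cong (⁅ x ⁆ ∪_) q≡y)
  where
  q≡y : q ≡ ⁅ y ⁆
  q≡y = trans q≡yr (trans (cong (⁅ y ⁆ ∪_) (∣p∣≡0⇒p≡∅ r ∣r∣≡0)) (∪-identityʳ ⁅ y ⁆))
  x≢y : x ≢ y
  x≢y refl = x∉q (subst (x ∈ₛ_) (sym q≡y) (x∈⁅x⁆ x))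

split-triple : (p : Subset n) → ∣ p ∣ ≡ 3 →
  Σ (Fin n) λ x → Σ (Fin n) λ y → Σ (Fin n) λ z → x ≢ y × y ≢ z × x ≢ z × p ≡ triple x y z
split-triple p ∣p∣≡3 with split-point p ∣p∣≡3
... | x , q , _ , p≡xq , ∣q∣≡2 with split-pair q ∣q∣≡2
... | y , z , _ , q≡yz =
  let p≡xyz = trans p≡xq (cong (⁅ x ⁆ ∪_) q≡yz)
      x≢y , y≢z , x≢z = ∣triple∣≡3⇒distinct (trans (cong ∣_∣ (sym p≡xyz)) ∣p∣≡3)
  in  x , y , z , x≢y , y≢z , x≢z , p≡xyz

comprehension : {P : Fin n → Set} → (∀ x → Dec (P x)) → Subset n
comprehension P? = tabulate (λ x → ⌊ P? x ⌋)

∈comprehension⁻ : {P : Fin n → Set} (P? : ∀ x → Dec (P x)) → x ∈ₛ comprehension P? → P x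
∈comprehension⁻ {x = x} P? x∈ =
  toWitness {a? = P? x} (subst T (sym (trans (sym (lookup∘tabulate _ x)) ([]=⇒lookup x∈))) _)

∈comprehension⁺ : {P : Fin n → Set} (P? : ∀ x → Dec (P x)) → P x → x ∈ₛ comprehension P?
∈comprehension⁺ {x = x} P? px =
  lookup⇒[]= x (comprehension P?) (trans (lookup∘tabulate _ x) (trans (isYes≗does (P? x)) (dec-true (P? x) px)))

module _ {a} {A : Set a} where

  ∈-delete : ∀ {x y : A} (ys zs : List A) → y ∈ ys ++ x ∷ zs → x ≢ y → y ∈ ys ++ zs
  ∈-delete ys zs y∈ x≢y with ∈-++⁻ ys y∈
  ... | inj₁ y∈ys         = ∈-++⁺ˡ y∈ys
  ... | inj₂ (here y≡x)   = ⊥-elim (x≢y (sym y≡x))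
  ... | inj₂ (there y∈zs) = ∈-++⁺ʳ ys y∈zs

  unique-⊆⇒length≤ : ∀ {xs ys : List A} → Unique xs → xs ⊆ ys → length xs ≤ length ys
  unique-⊆⇒length≤ {[]}     _             _     = z≤n
  unique-⊆⇒length≤ {x ∷ xs} (x∉xs ∷ !xs) xs⊆ys with ∈-∃++ (xs⊆ys (here refl))
  ... | ys , zs , refl =
    subst (suc (length xs) ≤_) (sym (length-++-sucʳ ys x zs)) (s≤s (unique-⊆⇒length≤ !xs xs⊆yszs))
    where
    xs⊆yszs : xs ⊆ ys ++ zs
    xs⊆yszs y∈xs = ∈-delete ys zs (xs⊆ys (there y∈xs)) (All.lookup x∉xs y∈xs)

  same-members⇒same-length : ∀ {xs ys : List A} → Unique xs → Unique ys →
                             xs ⊆ ys → ys ⊆ xs → length xs ≡ length ys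
  same-members⇒same-length !xs !ys xs⊆ys ys⊆xs =
    ℕP.≤-antisym (unique-⊆⇒length≤ !xs xs⊆ys) (unique-⊆⇒length≤ !ys ys⊆xs)

  unique-⊆-long⇒⊇ : DecidableEquality A → ∀ {xs ys : List A} → Unique xs → Unique ys →
                     xs ⊆ ys → length ys ≤ length xs → ys ⊆ xs
  unique-⊆-long⇒⊇ _≟_ {xs} {ys} !xs !ys xs⊆ys ys≤xs {y} y∈ys with Any.any? (y ≟_) xs
  ... | yes y∈xs = y∈xs
  ... | no  y∉xs = ⊥-elim (ℕP.<⇒≱ (unique-⊆⇒length≤ (All.tabulate y≢ ∷ !xs) yxs⊆ys) ys≤xs)
    where
    y≢ : ∀ {x} → x ∈ xs → y ≢ x
    y≢ x∈xs refl = y∉xs x∈xs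
    yxs⊆ys : y ∷ xs ⊆ ys
    yxs⊆ys (here refl)  = y∈ys
    yxs⊆ys (there x∈xs) = xs⊆ys x∈xs

  length-filter+length-reject : ∀ {p} {P : Pred A p} (P? : Decidable P) (xs : List A) →
    length (filter P? xs) + length (filter (¬? ∘ P?) xs) ≡ length xs
  length-filter+length-reject P? []       = refl
  length-filter+length-reject P? (x ∷ xs) with P? x
  ... | yes _ = cong suc (length-filter+length-reject P? xs)
  ... | no  _ = trans (ℕP.+-suc _ _) (cong suc (length-filter+length-reject P? xs))

module _ {a b} {A : Set a} {B : Set b} where

  length-concatMap : (f : A → List B) {k : ℕ} {xs : List A} →
                     (∀ {x} → x ∈ xs → length (f x) ≡ k) → length (concatMap f xs) ≡ length xs * k
  length-concatMap f {xs = []}     _      = refl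
  length-concatMap f {xs = x ∷ xs} ∣f∣≡k =
    trans (length-++ (f x)) (cong₂ _+_ (∣f∣≡k (here refl)) (length-concatMap f (∣f∣≡k ∘ there)))

  unique-concatMap : (f : A → List B) {xs : List A} → Unique xs →
                     (∀ {x} → x ∈ xs → Unique (f x)) →
                     (∀ {x y z} → x ∈ xs → y ∈ xs → z ∈ f x → z ∈ f y → x ≡ y) →
                     Unique (concatMap f xs)
  unique-concatMap f {[]}     _              _  _        = []
  unique-concatMap f {x ∷ xs} (x∉xs ∷ !xs) !f disjoint =
    Unique.++⁺ (!f (here refl)) (unique-concatMap f !xs (!f ∘ there) (λ x∈ y∈ → disjoint (there x∈) (there y∈)))
      λ (z∈fx , z∈rest) → let y , y∈xs , z∈fy = find (∈-concatMap⁻ f z∈rest)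
                           in All.lookup x∉xs y∈xs (disjoint (here refl) (there y∈xs) z∈fx z∈fy)

  collision⇒shorter : (g : A → B) {xs : List B} {ys : List A} {u v : A} → Unique xs → xs ⊆ map g ys →
                      u ∈ ys → v ∈ ys → u ≢ v → g u ≡ g v → length xs < length ys
  collision⇒shorter g {xs} {u = u} {v} !xs xs⊆gys u∈ys v∈ys u≢v gu≡gv with ∈-∃++ u∈ys
  ... | ys , zs , refl =
    subst (suc (length xs) ≤_) (sym (length-++-sucʳ ys u zs))
      (s≤s (subst (length xs ≤_) (length-map g (ys ++ zs)) (unique-⊆⇒length≤ !xs xs⊆gyszs)))
    where
    xs⊆gyszs : xs ⊆ map g (ys ++ zs)
    xs⊆gyszs x∈xs with ∈-map⁻ g (xs⊆gys x∈xs)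
    ... | w , w∈ , refl with ∈-++⁻ ys w∈
    ... | inj₁ w∈ys          = ∈-map⁺ g (∈-++⁺ˡ w∈ys)
    ... | inj₂ (there w∈zs)  = ∈-map⁺ g (∈-++⁺ʳ ys w∈zs)
    ... | inj₂ (here refl)   = subst (_∈ map g (ys ++ zs)) (sym gu≡gv) (∈-map⁺ g (∈-delete ys zs v∈ys u≢v))

  long-image⇒injective : DecidableEquality A → (g : A → B) {xs : List B} {ys : List A} →
                         Unique xs → xs ⊆ map g ys → length ys ≤ length xs →
                         ∀ {u v} → u ∈ ys → v ∈ ys → g u ≡ g v → u ≡ v
  long-image⇒injective _≟_ g !xs xs⊆gys ys≤xs {u} {v} u∈ys v∈ys gu≡gv with u ≟ v
  ... | yes u≡v = u≡v
  ... | no  u≢v = ⊥-elim (ℕP.<⇒≱ (collision⇒shorter g !xs xs⊆gys u∈ys v∈ys u≢v gu≡gv) ys≤xs)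


subsets : (n k : ℕ) → List (Subset n)
subsets zero    zero    = [] ∷ []
subsets zero    (suc k) = []
subsets (suc n) zero    = map (false ∷_) (subsets n zero)
subsets (suc n) (suc k) = map (true ∷_) (subsets n k) ++ map (false ∷_) (subsets n (suc k))

length-subsets : ∀ n k → length (subsets n k) ≡ n C k
length-subsets zero    zero    = refl
length-subsets zero    (suc k) = refl
length-subsets (suc n) zero    = trans (length-map (false ∷_) (subsets n zero)) (length-subsets n zero)
length-subsets (suc n) (suc k) = begin
  length (map (true ∷_) (subsets n k) ++ map (false ∷_) (subsets n (suc k)))
    ≡⟨ length-++ (map (true ∷_) (subsets n k)) ⟩
  length (map (true ∷_) (subsets n k)) + length (map (false ∷_) (subsets n (suc k)))
    ≡⟨ cong₂ _+_ (length-map (true ∷_) (subsets n k)) (length-map (false ∷_) (subsets n (suc k))) ⟩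
  length (subsets n k) + length (subsets n (suc k))
    ≡⟨ cong₂ _+_ (length-subsets n k) (length-subsets n (suc k)) ⟩
  n C k + n C suc k
    ≡⟨ nCk+nC[k+1]≡[n+1]C[k+1] n k ⟩
  suc n C suc k ∎
  where open ≡-Reasoning

∈subsets⁻ : ∀ {n k} {p : Subset n} → p ∈ subsets n k → ∣ p ∣ ≡ k
∈subsets⁻ {zero}  {zero}  (here refl) = refl
∈subsets⁻ {suc n} {zero}  p∈ with ∈-map⁻ (false ∷_) p∈
... | _ , q∈ , refl = ∈subsets⁻ q∈
∈subsets⁻ {suc n} {suc k} p∈ with ∈-++⁻ (map (true ∷_) (subsets n k)) p∈
... | inj₁ p∈₁ with ∈-map⁻ (true ∷_) p∈₁
...   | _ , q∈ , refl = cong suc (∈subsets⁻ q∈)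
∈subsets⁻ {suc n} {suc k} p∈ | inj₂ p∈₂ with ∈-map⁻ (false ∷_) p∈₂
...   | _ , q∈ , refl = ∈subsets⁻ q∈

∈subsets⁺ : ∀ {n k} (p : Subset n) → ∣ p ∣ ≡ k → p ∈ subsets n k
∈subsets⁺ {zero}  {zero}  []          _ = here refl
∈subsets⁺ {suc n} {zero}  (false ∷ p) ∣p∣≡0 = ∈-map⁺ (false ∷_) (∈subsets⁺ p ∣p∣≡0)
∈subsets⁺ {suc n} {suc k} (true  ∷ p) ∣p∣≡k =
  ∈-++⁺ˡ (∈-map⁺ (true ∷_) (∈subsets⁺ p (ℕP.suc-injective ∣p∣≡k)))
∈subsets⁺ {suc n} {suc k} (false ∷ p) ∣p∣≡k =
  ∈-++⁺ʳ (map (true ∷_) (subsets n k)) (∈-map⁺ (false ∷_) (∈subsets⁺ p ∣p∣≡k))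

unique-subsets : ∀ n k → Unique (subsets n k)
unique-subsets zero    zero    = [] ∷ []
unique-subsets zero    (suc k) = []
unique-subsets (suc n) zero    = Unique.map⁺ ∷-injectiveʳ (unique-subsets n zero)
unique-subsets (suc n) (suc k) =
  Unique.++⁺ (Unique.map⁺ ∷-injectiveʳ (unique-subsets n k))
             (Unique.map⁺ ∷-injectiveʳ (unique-subsets n (suc k))) disjoint
  where
  disjoint : ∀ {p} → ¬ (p ∈ map (true ∷_) (subsets n k) × p ∈ map (false ∷_) (subsets n (suc k)))
  disjoint (p∈₁ , p∈₂) with ∈-map⁻ (true ∷_) p∈₁ | ∈-map⁻ (false ∷_) p∈₂
  ... | _ , _ , refl | _ , _ , ()

pairsIn : ∀ {n} → Subset n → List (Subset n)
pairsIn {n} p = filter (_⊆? p) (subsets n 2)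

∈pairsIn⁻ : ∀ {n} {p q : Subset n} → q ∈ pairsIn p →
  ∃₂ λ x y → x ≢ y × q ≡ ⁅ x ⁆ ∪ ⁅ y ⁆ × q ⊆ₛ p
∈pairsIn⁻ {p = p} {q} q∈ with ∈-filter⁻ (_⊆? p) q∈
... | q∈subsets , q⊆p with split-pair q (∈subsets⁻ q∈subsets)
... | x , y , x≢y , q≡xy = x , y , x≢y , q≡xy , q⊆p

∈pairsIn⁺ : ∀ {n} {p : Subset n} {x y} → x ≢ y → x ∈ₛ p → y ∈ₛ p → ⁅ x ⁆ ∪ ⁅ y ⁆ ∈ pairsIn p
∈pairsIn⁺ {p = p} {x} {y} x≢y x∈p y∈p = ∈-filter⁺ (_⊆? p) (∈subsets⁺ _ (∣pair∣≡2 x≢y)) xy⊆p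
  where
  xy⊆p : ⁅ x ⁆ ∪ ⁅ y ⁆ ⊆ₛ p
  xy⊆p z∈ with ∈pair⁻ z∈
  ... | inj₁ refl = x∈p
  ... | inj₂ refl = y∈p

unique-pairsIn : ∀ {n} (p : Subset n) → Unique (pairsIn p)
unique-pairsIn {n} p = Unique.filter⁺ (_⊆? p) (unique-subsets n 2)

length-pairsIn : ∀ {n} (p : Subset n) → ∣ p ∣ ≡ 3 → length (pairsIn p) ≡ 3
length-pairsIn {n} p ∣p∣≡3 with split-triple p ∣p∣≡3
... | a , b , c , a≢b , b≢c , a≢c , refl =
  sym (same-members⇒same-length !sides (unique-pairsIn _) sides⊆ ⊆sides)
  where
  sides : List (Subset n)
  sides = ⁅ a ⁆ ∪ ⁅ b ⁆ ∷ ⁅ b ⁆ ∪ ⁅ c ⁆ ∷ ⁅ c ⁆ ∪ ⁅ a ⁆ ∷ []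
  differ : ∀ {x y z w} → x ≢ z → x ≢ w → ⁅ x ⁆ ∪ ⁅ y ⁆ ≢ ⁅ z ⁆ ∪ ⁅ w ⁆
  differ x≢z x≢w eq with ∈pair⁻ (subst (_ ∈ₛ_) eq (∈pair⁺ (inj₁ refl)))
  ... | inj₁ x≡z = x≢z x≡z
  ... | inj₂ x≡w = x≢w x≡w
  !sides : Unique sides
  !sides = (differ a≢b a≢c ∷ (differ (a≢c ∘ sym) (b≢c ∘ sym) ∘ sym) ∷ [])
         ∷ (differ b≢c (a≢b ∘ sym) ∷ [])
         ∷ []
         ∷ []
  Side : Fin n → Fin n → Set
  Side x y = ⁅ x ⁆ ∪ ⁅ y ⁆ ∈ sides
  ⊆sides : pairsIn (triple a b c) ⊆ sides
  ⊆sides q∈ with ∈pairsIn⁻ q∈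
  ... | x , y , x≢y , refl , xy⊆abc =
    triple-pairs Side (λ x y → subst (_∈ sides) (∪-comm ⁅ x ⁆ ⁅ y ⁆))
      (here refl) (there (here refl)) (there (there (here refl)))
      (∈triple⁻ (xy⊆abc (∈pair⁺ (inj₁ refl)))) (∈triple⁻ (xy⊆abc (∈pair⁺ (inj₂ refl)))) x≢y
  sides⊆ : sides ⊆ pairsIn (triple a b c)
  sides⊆ (here refl) = ∈pairsIn⁺ a≢b (∈triple⁺ (inj₁ refl)) (∈triple⁺ (inj₂ (inj₁ refl)))
  sides⊆ (there (here refl)) = ∈pairsIn⁺ b≢c (∈triple⁺ (inj₂ (inj₁ refl))) (∈triple⁺ (inj₂ (inj₂ refl)))
  sides⊆ (there (there (here refl))) = ∈pairsIn⁺ (a≢c ∘ sym) (∈triple⁺ (inj₂ (inj₂ refl))) (∈triple⁺ (inj₁ refl))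

module SteinerTripleSystem {n : ℕ} {S : List (Subset n)} (sts : IsSTS S) where
  open IsSTS sts

  infixl 7 _⋆_
  _⋆_ : Fin n → Fin n → Fin n
  a ⋆ b = star S a b

  block-distinct : ∀ {a b c} → triple a b c ∈ S → a ≢ b × b ≢ c × a ≢ c
  block-distinct abc∈S = ∣triple∣≡3⇒distinct (All.lookup blocks-3 abc∈S)

  completion : ∀ {a b} → a ≢ b → ∃ λ w → triple a b w ∈ S
  completion {a} {b} a≢b with pair-cover a b a≢b
  ... | B , B∈S , a∈B , b∈B with split-triple B (All.lookup blocks-3 B∈S)
  ... | p , q , r , _ , _ , _ , refl =
    let w , abw≡pqr = triple-pairs Completes flip
                        (r , refl)
                        (p , sym (triple-rotate p q r))
                        (q , triple-rotate r p q)
                        (∈triple⁻ a∈B) (∈triple⁻ b∈B) a≢b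
    in  w , subst (_∈ S) (sym abw≡pqr) B∈S
    where
    Completes : Fin n → Fin n → Set
    Completes x y = ∃ λ z → triple x y z ≡ triple p q r
    flip : ∀ x y → Completes x y → Completes y x
    flip x y (z , xyz≡pqr) = z , trans (triple-swap₁₂ y x z) xyz≡pqr

  ⋆-block : ∀ {a b} → a ≢ b → triple a b (a ⋆ b) ∈ S
  ⋆-block {a} {b} a≢b with a ≟ b
  ... | yes a≡b = ⊥-elim (a≢b a≡b)
  ... | no  _ with any? (λ c → triple a b c ∈? S)
  ...   | yes (c , abc∈S) = abc∈S
  ...   | no  ¬completion = ⊥-elim (¬completion (completion a≢b))

  ⋆-unique : ∀ {a b w} → triple a b w ∈ S → a ⋆ b ≡ w
  ⋆-unique {a} {b} {w} abw∈S = third (∈triple⁻ w∈ab⋆)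
    where
    a≢b : a ≢ b
    a≢b = proj₁ (block-distinct abw∈S)
    same-block : triple a b (a ⋆ b) ≡ triple a b w
    same-block = pair-unique a b a≢b _ _
      (⋆-block a≢b) (∈triple⁺ (inj₁ refl)) (∈triple⁺ (inj₂ (inj₁ refl)))
      abw∈S         (∈triple⁺ (inj₁ refl)) (∈triple⁺ (inj₂ (inj₁ refl)))
    w∈ab⋆ : w ∈ₛ triple a b (a ⋆ b)
    w∈ab⋆ = subst (w ∈ₛ_) (sym same-block) (∈triple⁺ (inj₂ (inj₂ refl)))
    third : In₃ w a b (a ⋆ b) → a ⋆ b ≡ w
    third (inj₁ w≡a)         = ⊥-elim (proj₂ (proj₂ (block-distinct abw∈S)) (sym w≡a))
    third (inj₂ (inj₁ w≡b))  = ⊥-elim (proj₁ (proj₂ (block-distinct abw∈S)) (sym w≡b))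
    third (inj₂ (inj₂ w≡ab)) = sym w≡ab

  ⋆-comm : ∀ a b → a ⋆ b ≡ b ⋆ a
  ⋆-comm a b = by-cases (a ≟ b)
    where
    by-cases : Dec (a ≡ b) → a ⋆ b ≡ b ⋆ a
    by-cases (yes refl) = refl
    by-cases (no a≢b)   = sym (⋆-unique (subst (_∈ S) (triple-swap₁₂ a b (a ⋆ b)) (⋆-block a≢b)))

  ⋆-distinct : ∀ {a b} → a ≢ b → a ⋆ b ≢ a × a ⋆ b ≢ b
  ⋆-distinct a≢b with block-distinct (⋆-block a≢b)
  ... | _ , b≢ab , a≢ab = a≢ab ∘ sym , b≢ab ∘ sym

  ⋆-involutive : ∀ {a b} → a ≢ b → a ⋆ (a ⋆ b) ≡ b
  ⋆-involutive {a} {b} a≢b = ⋆-unique (subst (_∈ S) (triple-swap₂₃ a b (a ⋆ b)) (⋆-block a≢b))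

  ⋆-cancelˡ : ∀ {a b c} → a ≢ b → a ≢ c → a ⋆ b ≡ a ⋆ c → b ≡ c
  ⋆-cancelˡ {a} {b} {c} a≢b a≢c ab≡ac = begin
    b             ≡⟨ ⋆-involutive a≢b ⟨
    a ⋆ (a ⋆ b)   ≡⟨ cong (a ⋆_) ab≡ac ⟩
    a ⋆ (a ⋆ c)   ≡⟨ ⋆-involutive a≢c ⟩
    c             ∎
    where open ≡-Reasoning

  triangle : Fin n → Fin n → Fin n → Subset n
  triangle a b c = triple (a ⋆ b) (b ⋆ c) (c ⋆ a)

  triangle-block : ∀ {a b c} → triple a b c ∈ S → triangle a b c ≡ triple a b c
  triangle-block {a} {b} {c} abc∈S = begin
    triple (a ⋆ b) (b ⋆ c) (c ⋆ a)  ≡⟨ cong₂ (λ x y → triple x y (c ⋆ a)) (⋆-unique abc∈S) (⋆-unique bca∈S) ⟩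
    triple c a (c ⋆ a)              ≡⟨ cong (triple c a) (⋆-unique cab∈S) ⟩
    triple c a b                    ≡⟨ triple-rotate b c a ⟨
    triple b c a                    ≡⟨ triple-rotate a b c ⟨
    triple a b c                    ∎
    where
    open ≡-Reasoning
    bca∈S : triple b c a ∈ S
    bca∈S = subst (_∈ S) (triple-rotate a b c) abc∈S
    cab∈S : triple c a b ∈ S
    cab∈S = subst (_∈ S) (triple-rotate b c a) bca∈S

  triangle-distinct : ∀ {a b c} → a ≢ b → b ≢ c → a ≢ c → a ⋆ b ≢ b ⋆ c × b ⋆ c ≢ c ⋆ a × a ⋆ b ≢ c ⋆ a
  triangle-distinct {a} {b} {c} a≢b b≢c a≢c =
      (λ ab≡bc → a≢c (⋆-cancelˡ (a≢b ∘ sym) b≢c (trans (⋆-comm b a) ab≡bc)))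
    , (λ bc≡ca → a≢b (sym (⋆-cancelˡ (b≢c ∘ sym) (a≢c ∘ sym) (trans (⋆-comm c b) bc≡ca))))
    , (λ ab≡ca → b≢c (⋆-cancelˡ a≢b a≢c (trans ab≡ca (⋆-comm c a))))

  products : Subset n → Subset n
  products X = comprehension λ z → any? λ x → any? λ y →
    (x ∈ₛ? X) ×-dec (y ∈ₛ? X) ×-dec ¬? (x ≟ y) ×-dec (z ≟ x ⋆ y)

  products-triple : ∀ {a b c} → a ≢ b → b ≢ c → a ≢ c → products (triple a b c) ≡ triangle a b c
  products-triple {a} {b} {c} a≢b b≢c a≢c = ⊆-antisym ⊆triangle triangle⊆
    where
    InTriangle : Fin n → Fin n → Set
    InTriangle x y = In₃ (x ⋆ y) (a ⋆ b) (b ⋆ c) (c ⋆ a)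
    flip : ∀ x y → InTriangle x y → InTriangle y x
    flip x y = subst (λ z → In₃ z (a ⋆ b) (b ⋆ c) (c ⋆ a)) (⋆-comm x y)
    ⊆triangle : ∀ {z} → z ∈ₛ products (triple a b c) → z ∈ₛ triangle a b c
    ⊆triangle z∈ with ∈comprehension⁻ _ z∈
    ... | x , y , x∈ , y∈ , x≢y , refl = ∈triple⁺
      (triple-pairs InTriangle flip (inj₁ refl) (inj₂ (inj₁ refl)) (inj₂ (inj₂ refl))
                    (∈triple⁻ x∈) (∈triple⁻ y∈) x≢y)
    product : ∀ {x y} → In₃ x a b c → In₃ y a b c → x ≢ y → x ⋆ y ∈ₛ products (triple a b c)
    product {x} {y} x∈ y∈ x≢y = ∈comprehension⁺ _ (x , y , ∈triple⁺ x∈ , ∈triple⁺ y∈ , x≢y , refl)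
    triangle⊆ : ∀ {z} → z ∈ₛ triangle a b c → z ∈ₛ products (triple a b c)
    triangle⊆ z∈ with ∈triple⁻ z∈
    ... | inj₁ refl        = product (inj₁ refl) (inj₂ (inj₁ refl)) a≢b
    ... | inj₂ (inj₁ refl) = product (inj₂ (inj₁ refl)) (inj₂ (inj₂ refl)) b≢c
    ... | inj₂ (inj₂ refl) = product (inj₂ (inj₂ refl)) (inj₁ refl) (a≢c ∘ sym)

  products-size : ∀ {X} → ∣ X ∣ ≡ 3 → ∣ products X ∣ ≡ 3
  products-size {X} ∣X∣≡3 with split-triple X ∣X∣≡3
  ... | a , b , c , a≢b , b≢c , a≢c , refl with triangle-distinct a≢b b≢c a≢c
  ...   | ab≢bc , bc≢ca , ab≢ca = trans (cong ∣_∣ (products-triple a≢b b≢c a≢c)) (∣triple∣≡3 ab≢bc bc≢ca ab≢ca)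

  products-block : ∀ {X} → X ∈ S → products X ≡ X
  products-block {X} X∈S with split-triple X (All.lookup blocks-3 X∈S)
  ... | a , b , c , a≢b , b≢c , a≢c , refl = trans (products-triple a≢b b≢c a≢c) (triangle-block X∈S)

  record Collision : Set where
    field
      u v          : Subset n
      u≢v          : u ≢ v
      ∣u∣≡3        : ∣ u ∣ ≡ 3
      ∣v∣≡3        : ∣ v ∣ ≡ 3
      u∉S          : ¬ u ∈ S
      v∉S          : ¬ v ∈ S
      same-products : products u ≡ products v

  -- Pasch configuration: if the triangle {ab, bc, ca} (ab = a⋆b, bc = b⋆c,
  -- ca = c⋆a) of a non-block {a, b, c} is a block, then the two non-blocks
  -- {a, b, ca} and {b, ca, bc} both have triangle {ab, b⋆ca, c}.
  pasch : ∀ {X} → ∣ X ∣ ≡ 3 → ¬ X ∈ S → products X ∈ S → Collision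
  pasch {X} ∣X∣≡3 X∉S GX∈S with split-triple X ∣X∣≡3
  ... | a , b , c , a≢b , b≢c , a≢c , refl = record
    { u = triple a b ca ; v = triple b ca bc ; u≢v = u≢v
    ; ∣u∣≡3 = ∣triple∣≡3 a≢b b≢ca a≢ca ; ∣v∣≡3 = ∣triple∣≡3 b≢ca ca≢bc b≢bc
    ; u∉S = u∉S ; v∉S = v∉S
    ; same-products = begin
        products (triple a b ca)       ≡⟨ products-triple a≢b b≢ca a≢ca ⟩
        triple ab (b ⋆ ca) (ca ⋆ a)    ≡⟨ cong (triple ab (b ⋆ ca)) ca⋆a≡c ⟩
        triple ab (b ⋆ ca) c           ≡⟨ triple-swap₁₂ ab (b ⋆ ca) c ⟩
        triple (b ⋆ ca) ab c           ≡⟨ cong₂ (triple (b ⋆ ca)) ca⋆bc≡ab bc⋆b≡c ⟨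
        triangle b ca bc               ≡⟨ products-triple b≢ca ca≢bc b≢bc ⟨
        products (triple b ca bc)      ∎
    }
    where
    open ≡-Reasoning
    ab bc ca : Fin n
    ab = a ⋆ b
    bc = b ⋆ c
    ca = c ⋆ a
    triangle∈S : triple ab bc ca ∈ S
    triangle∈S = subst (_∈ S) (products-triple a≢b b≢c a≢c) GX∈S
    ca⋆a≡c : ca ⋆ a ≡ c
    ca⋆a≡c = trans (⋆-comm ca a) (trans (cong (a ⋆_) (⋆-comm c a)) (⋆-involutive a≢c))
    bc⋆b≡c : bc ⋆ b ≡ c
    bc⋆b≡c = trans (⋆-comm bc b) (⋆-involutive b≢c)
    ca⋆bc≡ab : ca ⋆ bc ≡ ab
    ca⋆bc≡ab = ⋆-unique (subst (_∈ S) (trans (triple-rotate ab bc ca)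
                 (trans (triple-rotate bc ca ab) (triple-swap₂₃ ca ab bc))) triangle∈S)
    -- b = c⋆a or a = b⋆c would make {a, b, c} a block
    b≢ca : b ≢ ca
    b≢ca b≡ca = X∉S (subst (_∈ S) (trans (cong (triple c a) (sym b≡ca))
                 (sym (trans (triple-rotate a b c) (triple-rotate b c a)))) (⋆-block (a≢c ∘ sym)))
    a≢bc : a ≢ bc
    a≢bc a≡bc = X∉S (subst (_∈ S) (trans (cong (triple b c) (sym a≡bc)) (sym (triple-rotate a b c))) (⋆-block b≢c))
    a≢ca : a ≢ ca
    a≢ca = proj₂ (⋆-distinct (a≢c ∘ sym)) ∘ sym
    b≢bc : b ≢ bc
    b≢bc = proj₁ (⋆-distinct b≢c) ∘ sym
    ca≢bc : ca ≢ bc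
    ca≢bc ca≡bc = a≢b (⋆-cancelˡ (a≢c ∘ sym) (b≢c ∘ sym) (trans ca≡bc (⋆-comm b c)))
    u∉S : ¬ triple a b ca ∈ S
    u∉S abca∈S = b≢c (⋆-cancelˡ a≢b a≢c (trans (⋆-unique abca∈S) (⋆-comm c a)))
    v∉S : ¬ triple b ca bc ∈ S
    v∉S bcabc∈S = proj₂ (⋆-distinct a≢b)
                    (trans (sym ca⋆bc≡ab) (⋆-unique (subst (_∈ S) (triple-rotate b ca bc) bcabc∈S)))
    u≢v : triple a b ca ≢ triple b ca bc
    u≢v u≡v with ∈triple⁻ (subst (a ∈ₛ_) u≡v (∈triple⁺ (inj₁ refl)))
    ... | inj₁ a≡b         = a≢b a≡b
    ... | inj₂ (inj₁ a≡ca) = a≢ca a≡ca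
    ... | inj₂ (inj₂ a≡bc) = a≢bc a≡bc

  -- Every pair lies in exactly one block and every block has three pairs,
  -- so 3|S| = C(n,2).
  blockPairs : List (Subset n)
  blockPairs = concatMap pairsIn S

  blockPairs⊆pairs : blockPairs ⊆ subsets n 2
  blockPairs⊆pairs q∈ with find (∈-concatMap⁻ pairsIn {xs = S} q∈)
  ... | B , _ , q∈pairsB with ∈pairsIn⁻ q∈pairsB
  ...   | x , y , x≢y , refl , _ = ∈subsets⁺ _ (∣pair∣≡2 x≢y)

  pairs⊆blockPairs : subsets n 2 ⊆ blockPairs
  pairs⊆blockPairs {q} q∈ with split-pair q (∈subsets⁻ q∈)
  ... | x , y , x≢y , refl with pair-cover x y x≢y
  ...   | B , B∈S , x∈B , y∈B = ∈-concatMap⁺ pairsIn (lose B∈S (∈pairsIn⁺ x≢y x∈B y∈B))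

  pair-determines-block : ∀ {B B′ q} → B ∈ S → B′ ∈ S → q ∈ pairsIn B → q ∈ pairsIn B′ → B ≡ B′
  pair-determines-block B∈S B′∈S q∈pairsB q∈pairsB′ with ∈pairsIn⁻ q∈pairsB | ∈pairsIn⁻ q∈pairsB′
  ... | x , y , x≢y , refl , xy⊆B | _ , _ , _ , _ , xy⊆B′ =
    pair-unique x y x≢y _ _
      B∈S  (xy⊆B  (∈pair⁺ (inj₁ refl))) (xy⊆B  (∈pair⁺ (inj₂ refl)))
      B′∈S (xy⊆B′ (∈pair⁺ (inj₁ refl))) (xy⊆B′ (∈pair⁺ (inj₂ refl)))

  number-of-blocks : length S * 3 ≡ n C 2
  number-of-blocks = begin
    length S * 3          ≡⟨ length-concatMap pairsIn {xs = S} (λ {B} B∈S → length-pairsIn B (All.lookup blocks-3 B∈S)) ⟨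
    length blockPairs     ≡⟨ same-members⇒same-length !blockPairs (unique-subsets n 2) blockPairs⊆pairs pairs⊆blockPairs ⟩
    length (subsets n 2)  ≡⟨ length-subsets n 2 ⟩
    n C 2                 ∎
    where
    open ≡-Reasoning
    !blockPairs : Unique blockPairs
    !blockPairs = unique-concatMap pairsIn isSet (λ _ → unique-pairsIn _) pair-determines-block

module Images {n : ℕ} {S : List (Subset n)} (sts : IsSTS S) where
  open SteinerTripleSystem sts

  record KeptTriangle (keep : Fin n → Fin n → Fin n → Bool) (Y : Subset n) : Set where
    constructor kept
    field
      {p q r}  : Fin n
      p≢q      : p ≢ q
      q≢r      : q ≢ r
      p≢r      : p ≢ r
      selected : keep p q r ≡ true
      Y≡       : Y ≡ triangle p q r

  -- What the ordered triple (a, b, c) contributes to `images S keep`, with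
  -- the three equality tests made explicit so that they can be matched on.
  contribution : (Fin n → Fin n → Fin n → Bool) → (a b c : Fin n) →
                 Dec (a ≡ b) → Dec (b ≡ c) → Dec (a ≡ c) → List (Subset n)
  contribution keep a b c a≟b b≟c a≟c =
    if ⌊ a≟b ⌋ then [] else
    if ⌊ b≟c ⌋ then [] else
    if ⌊ a≟c ⌋ then [] else
    if keep a b c then triangle a b c ∷ [] else []

  ∈contribution⁻ : ∀ {keep a b c} a≟b b≟c a≟c {Y} → Y ∈ contribution keep a b c a≟b b≟c a≟c →
                   KeptTriangle keep Y
  ∈contribution⁻ (yes _) _ _ ()
  ∈contribution⁻ (no _) (yes _) _ ()
  ∈contribution⁻ (no _) (no _) (yes _) ()
  ∈contribution⁻ {keep} {a} {b} {c} (no a≢b) (no b≢c) (no a≢c) Y∈ with keep a b c in selected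
  ∈contribution⁻ (no a≢b) (no b≢c) (no a≢c) (here Y≡) | true = kept a≢b b≢c a≢c selected Y≡
  ∈contribution⁻ (no a≢b) (no b≢c) (no a≢c) ()        | false

  ∈contribution⁺ : ∀ {keep a b c} a≟b b≟c a≟c → a ≢ b → b ≢ c → a ≢ c → keep a b c ≡ true →
                   triangle a b c ∈ contribution keep a b c a≟b b≟c a≟c
  ∈contribution⁺ (yes a≡b) _ _ a≢b _ _ _ = ⊥-elim (a≢b a≡b)
  ∈contribution⁺ (no _) (yes b≡c) _ _ b≢c _ _ = ⊥-elim (b≢c b≡c)
  ∈contribution⁺ (no _) (no _) (yes a≡c) _ _ a≢c _ = ⊥-elim (a≢c a≡c)
  ∈contribution⁺ (no _) (no _) (no _) _ _ _ selected rewrite selected = here refl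

  ∈images⁻ : ∀ {keep Y} → Y ∈ images S keep → KeptTriangle keep Y
  ∈images⁻ {keep} Y∈ =
    let a , _ , Y∈a = find (∈-concatMap⁻ _ {xs = allFin n} Y∈)
        b , _ , Y∈b = find (∈-concatMap⁻ _ {xs = allFin n} Y∈a)
        c , _ , Y∈c = find (∈-concatMap⁻ (λ c → contribution keep a b c (a ≟ b) (b ≟ c) (a ≟ c)) {xs = allFin n} Y∈b)
    in  ∈contribution⁻ (a ≟ b) (b ≟ c) (a ≟ c) Y∈c

  ∈images⁺ : ∀ {keep a b c} → a ≢ b → b ≢ c → a ≢ c → keep a b c ≡ true → triangle a b c ∈ images S keep
  ∈images⁺ {keep} {a} {b} {c} a≢b b≢c a≢c selected =
    ∈-concatMap⁺ _ (lose (∈-allFin a)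
      (∈-concatMap⁺ _ (lose (∈-allFin b)
        (∈-concatMap⁺ (λ c → contribution keep a b c (a ≟ b) (b ≟ c) (a ≟ c)) (lose (∈-allFin c)
          (∈contribution⁺ {keep} (a ≟ b) (b ≟ c) (a ≟ c) a≢b b≢c a≢c selected))))))

  images⊆products : ∀ {keep} {L : List (Subset n)} →
    (∀ {a b c} → a ≢ b → b ≢ c → a ≢ c → keep a b c ≡ true → triple a b c ∈ L) →
    images S keep ⊆ map products L
  images⊆products {L = L} selected⇒∈L Y∈ =
    let kept p≢q q≢r p≢r selected Y≡ = ∈images⁻ Y∈
    in  subst (_∈ map products L) (trans (products-triple p≢q q≢r p≢r) (sym Y≡))
              (∈-map⁺ products (selected⇒∈L p≢q q≢r p≢r selected))

  products⊆images : ∀ {keep} {L : List (Subset n)} →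
    (∀ {X} → X ∈ L → ∣ X ∣ ≡ 3) → (∀ {a b c} → triple a b c ∈ L → keep a b c ≡ true) →
    ∀ {X} → X ∈ L → products X ∈ images S keep
  products⊆images size selected {X} X∈L with split-triple X (size X∈L)
  ... | a , b , c , a≢b , b≢c , a≢c , refl =
    subst (_∈ images S _) (sym (products-triple a≢b b≢c a≢c)) (∈images⁺ a≢b b≢c a≢c (selected X∈L))


rejects⁻ : ∀ {P : Set} (P? : Dec P) → (if ⌊ P? ⌋ then false else true) ≡ true → ¬ P
rejects⁻ (yes _) ()
rejects⁻ (no ¬p) _ = ¬p

rejects⁺ : ∀ {P : Set} (P? : Dec P) → ¬ P → (if ⌊ P? ⌋ then false else true) ≡ true
rejects⁺ (yes p) ¬p = ⊥-elim (¬p p)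
rejects⁺ (no _)  _  = refl

module Main {n : ℕ} {S : List (Subset n)} (sts : IsSTS S) where
  open IsSTS sts
  open SteinerTripleSystem sts
  open Images sts

  triples : List (Subset n)
  triples = subsets n 3

  nonBlocks : List (Subset n)
  nonBlocks = filter (¬? ∘ (_∈? S)) triples

  ∈nonBlocks⁺ : ∀ {X} → ∣ X ∣ ≡ 3 → ¬ X ∈ S → X ∈ nonBlocks
  ∈nonBlocks⁺ ∣X∣≡3 X∉S = ∈-filter⁺ (¬? ∘ (_∈? S)) (∈subsets⁺ _ ∣X∣≡3) X∉S

  ∈nonBlocks⁻ : ∀ {X} → X ∈ nonBlocks → ∣ X ∣ ≡ 3 × ¬ X ∈ S
  ∈nonBlocks⁻ X∈ with ∈-filter⁻ (¬? ∘ (_∈? S)) {xs = triples} X∈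
  ... | X∈triples , X∉S = ∈subsets⁻ X∈triples , X∉S

  length-nonBlocks : length nonBlocks ≡ n C 3 ∸ (n C 2) / 3
  length-nonBlocks = begin
    length nonBlocks                          ≡⟨ ℕP.m+n∸m≡n (length blocks) (length nonBlocks) ⟨
    length blocks + length nonBlocks ∸ length blocks
                                              ≡⟨ cong₂ _∸_ (length-filter+length-reject (_∈? S) triples) length-blocks ⟩
    length triples ∸ (n C 2) / 3              ≡⟨ cong (_∸ (n C 2) / 3) (length-subsets n 3) ⟩
    n C 3 ∸ (n C 2) / 3                       ∎
    where
    open ≡-Reasoning
    blocks : List (Subset n)
    blocks = filter (_∈? S) triples
    length-blocks : length blocks ≡ (n C 2) / 3
    length-blocks = begin
      length blocks       ≡⟨ same-members⇒same-length (Unique.filter⁺ (_∈? S) (unique-subsets n 3)) isSet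
                               (λ B∈ → let _ , B∈S = ∈-filter⁻ (_∈? S) {xs = triples} B∈ in B∈S)
                               (λ B∈S → ∈-filter⁺ (_∈? S) (∈subsets⁺ _ (All.lookup blocks-3 B∈S)) B∈S) ⟩
      length S            ≡⟨ m*n/n≡m (length S) 3 ⟨
      length S * 3 / 3    ≡⟨ cong (_/ 3) number-of-blocks ⟩
      (n C 2) / 3         ∎

  A⊆products : A-list S ⊆ map products nonBlocks
  A⊆products = images⊆products (λ a≢b b≢c a≢c selected → ∈nonBlocks⁺ (∣triple∣≡3 a≢b b≢c a≢c) (rejects⁻ _ selected))
             ∘ ∈-deduplicate⁻ _≟ₛ_ _

  products∈A : ∀ {X} → X ∈ nonBlocks → products X ∈ A-list S
  products∈A = ∈-deduplicate⁺ _≟ₛ_ ∘ products⊆images (proj₁ ∘ ∈nonBlocks⁻) (rejects⁺ _ ∘ proj₂ ∘ ∈nonBlocks⁻)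

  B⊆products : B-list S ⊆ map products triples
  B⊆products = images⊆products (λ a≢b b≢c a≢c _ → ∈subsets⁺ _ (∣triple∣≡3 a≢b b≢c a≢c)) ∘ ∈-deduplicate⁻ _≟ₛ_ _

  products∈B : ∀ {X} → X ∈ triples → products X ∈ B-list S
  products∈B = ∈-deduplicate⁺ _≟ₛ_ ∘ products⊆images ∈subsets⁻ (λ _ → refl)

  ProductsInjectiveOn : List (Subset n) → Set
  ProductsInjectiveOn L = ∀ {u v} → u ∈ L → v ∈ L → products u ≡ products v → u ≡ v

  -- Without a Pasch collision no non-block has a block as its products.
  products-nonBlock : ProductsInjectiveOn nonBlocks → ∀ {X} → X ∈ nonBlocks → products X ∈ nonBlocks
  products-nonBlock injective X∈ with ∈nonBlocks⁻ X∈
  ... | ∣X∣≡3 , X∉S = ∈nonBlocks⁺ (products-size ∣X∣≡3) no-collision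
    where
    no-collision : ¬ products _ ∈ S
    no-collision GX∈S =
      let open Collision (pasch ∣X∣≡3 X∉S GX∈S)
      in  u≢v (injective (∈nonBlocks⁺ ∣u∣≡3 u∉S) (∈nonBlocks⁺ ∣v∣≡3 v∉S) same-products)

  A⊆nonBlocks : ProductsInjectiveOn nonBlocks → A-list S ⊆ nonBlocks
  A⊆nonBlocks injective Y∈A =
    let X , X∈N , Y≡GX = ∈-map⁻ products (A⊆products Y∈A)
    in  subst (_∈ nonBlocks) (sym Y≡GX) (products-nonBlock injective X∈N)

  B⊆triples : B-list S ⊆ triples
  B⊆triples Y∈B =
    let X , X∈T , Y≡GX = ∈-map⁻ products (B⊆products Y∈B)
    in  ∈subsets⁺ _ (trans (cong ∣_∣ Y≡GX) (products-size (∈subsets⁻ X∈T)))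

  nonBlocks⊆triples : nonBlocks ⊆ triples
  nonBlocks⊆triples = ∈subsets⁺ _ ∘ proj₁ ∘ ∈nonBlocks⁻

  !A : Unique (A-list S)
  !A = DecUnique.deduplicate-! _≟ₛ_ _

  !B : Unique (B-list S)
  !B = DecUnique.deduplicate-! _≟ₛ_ _

  !nonBlocks : Unique nonBlocks
  !nonBlocks = Unique.filter⁺ (¬? ∘ (_∈? S)) (unique-subsets n 3)

  -- If α(S) = |N|, products is injective on N, hence maps N onto itself;
  -- together with the blocks (which it fixes) it then covers all triples.
  forward : α S ≡ length nonBlocks → β S ≡ length triples
  forward α≡∣N∣ = same-members⇒same-length !B (unique-subsets n 3) B⊆triples triples⊆B
    where
    injective : ProductsInjectiveOn nonBlocks
    injective = long-image⇒injective _≟ₛ_ products !A A⊆products (ℕP.≤-reflexive (sym α≡∣N∣))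
    N⊆A : nonBlocks ⊆ A-list S
    N⊆A = unique-⊆-long⇒⊇ _≟ₛ_ !A !nonBlocks (A⊆nonBlocks injective) (ℕP.≤-reflexive (sym α≡∣N∣))
    triples⊆B : triples ⊆ B-list S
    triples⊆B {X} X∈T = by-cases (X ∈? S)
      where
      by-cases : Dec (X ∈ S) → X ∈ B-list S
      by-cases (yes X∈S) = subst (_∈ B-list S) (products-block X∈S) (products∈B X∈T)
      by-cases (no X∉S) =
        let Y , Y∈N , X≡GY = ∈-map⁻ products (A⊆products (N⊆A (∈nonBlocks⁺ (∈subsets⁻ X∈T) X∉S)))
        in  subst (_∈ B-list S) (sym X≡GY) (products∈B (nonBlocks⊆triples Y∈N))

  -- If β(S) = |T|, products is injective on T, and every non-block is the
  -- products of some triple, which cannot be a block (blocks are fixed).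
  backward : β S ≡ length triples → α S ≡ length nonBlocks
  backward β≡∣T∣ = same-members⇒same-length !A !nonBlocks (A⊆nonBlocks injective) N⊆A
    where
    injective : ProductsInjectiveOn nonBlocks
    injective u∈ v∈ = long-image⇒injective _≟ₛ_ products !B B⊆products (ℕP.≤-reflexive (sym β≡∣T∣))
                        (nonBlocks⊆triples u∈) (nonBlocks⊆triples v∈)
    T⊆B : triples ⊆ B-list S
    T⊆B = unique-⊆-long⇒⊇ _≟ₛ_ !B (unique-subsets n 3) B⊆triples (ℕP.≤-reflexive (sym β≡∣T∣))
    N⊆A : nonBlocks ⊆ A-list S
    N⊆A {X} X∈N =
      let ∣X∣≡3 , X∉S    = ∈nonBlocks⁻ X∈N
          Y , Y∈T , X≡GY = ∈-map⁻ products (B⊆products (T⊆B (∈subsets⁺ X ∣X∣≡3)))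
          Y∉S : ¬ Y ∈ S
          Y∉S Y∈S = X∉S (subst (_∈ S) (sym (trans X≡GY (products-block Y∈S))) Y∈S)
      in  subst (_∈ A-list S) (sym X≡GY) (products∈A (∈nonBlocks⁺ (∈subsets⁻ Y∈T) Y∉S))

proposition2p6 : (n : ℕ) (S : List (Subset n)) → IsSTS S →
    (α S ≡ (n C 3) ∸ ((n C 2) / 3)) ⇔ (β S ≡ n C 3)
proposition2p6 n S sts = mk⇔
  (λ α≡ → trans (forward (trans α≡ (sym length-nonBlocks))) (length-subsets n 3))
  (λ β≡ → trans (backward (trans β≡ (sym (length-subsets n 3)))) length-nonBlocks)
  where open Main sts
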